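{- Let $\Sigma$ be a set of program states, $\mathsf{Prop}$ a set of atomic assertions with $\vDash_\Sigma\subseteq\Sigma\times\mathsf{Prop}$, and $C$ a program with nondeterministic denotation $[\![C]\!]:\Sigma\to2^\Sigma$. For all $P,Q\in\mathsf{Prop}$, \[\vDash\{\!|P|\!\}\,C\,\{\!|Q|\!\}\quad\text{iff}\quad\vDash\langle P\rangle C\langle Q\oplus\top\rangle.\]
   Context: Backwards under-approximate triple: $\vDash\{\!|P|\!\}C\{\!|Q|\!\}$ iff for every $\sigma\in\Sigma$ with $\sigma\vDash_\Sigma P$ there exists $\tau\in[\![C]\!](\sigma)$ with $\tau\vDash_\Sigma Q$. Nondeterministic Outcome Logic: $[\![C]\!]^\dagger(S)=\bigcup_{\sigma\in S}[\![C]\!](\sigma)$ for $S\subseteq\Sigma$; $S\vDash\top$ always; $S\vDash\varphi\oplus\psi$ iff $S=S_1\cup S_2$ with $S_1\vDash\varphi$ and $S_2\vDash\psi$; for atomic $P$, $S\vDash P$ iff $S\ne\emptyset$ and $\sigma\vDash_\Sigma P$ for all $\sigma\in S$. $\vDash\langle\varphi\rangle C\langle\psi\rangle$ iff for all $S\subseteq\Sigma$, $S\vDash\varphi$ implies $[\![C]\!]^\dagger(S)\vDash\psi$. -}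

module Defs where

open import Level using (Level; _⊔_; suc)
open import Data.Product using (Σ-syntax; ∃-syntax; _×_)
open import Data.Sum using (_⊎_)
open import Function.Bundles using (_⇔_)

Subset : Set → Set₁
Subset St = St → Set

_≐_∪_ : {St : Set} → Subset St → Subset St → Subset St → Set
S ≐ S₁ ∪ S₂ = ∀ σ → S σ ⇔ (S₁ σ ⊎ S₂ σ)

Denot : Set → Set₁
Denot St = St → Subset St

lift : {St : Set} → Denot St → Subset St → Subset St
lift C S τ = ∃[ σ ] (S σ × C σ τ)

BUTriple : {St Prop : Set} → (St → Prop → Set) → Prop → Denot St → Prop → Set
BUTriple {St} sat P C Q = ∀ (σ : St) → sat σ P → ∃[ τ ] (C σ τ × sat τ Q)

data Formula (Prop : Set) : Set where
  ⊤ᶠ   : Formula Prop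
  _⊕_  : Formula Prop → Formula Prop → Formula Prop
  atom : Prop → Formula Prop

-- Satisfaction  S ⊨ φ  of outcome-logic formulas by sets of states.
-- "S ≠ ∅" is read constructively as "S is inhabited".
OLsat : {St Prop : Set} → (St → Prop → Set) → Subset St → Formula Prop → Set₁
OLsat sat S ⊤ᶠ = Level.Lift _ Data.Unit.⊤
  where import Data.Unit
OLsat sat S (φ ⊕ ψ) =
  Σ[ S₁ ∈ Subset _ ] Σ[ S₂ ∈ Subset _ ] ((S ≐ S₁ ∪ S₂) × OLsat sat S₁ φ × OLsat sat S₂ ψ)
OLsat sat S (atom P) = Level.Lift _ ((∃[ σ ] S σ) × (∀ σ → S σ → sat σ P))

OLTriple : {St Prop : Set} → (St → Prop → Set) → Formula Prop → Denot St → Formula Prop → Set₁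
OLTriple {St} sat φ C ψ = ∀ (S : Subset St) → OLsat sat S φ → OLsat sat (lift C S) ψ

-- Adding ⊕ ⊤ to a postcondition weakens "all outcomes satisfy Q" to "some nonempty
-- subset of the outcomes satisfies Q", i.e. "some outcome satisfies Q". Applied to the
-- singleton {σ} this is exactly the under-approximate requirement on σ; conversely, for
-- any S ⊨ P, the Q-outcomes reached from S form such a nonempty subset of ⟦C⟧†(S).
module Submission where

open import Defs
open import Data.Product using (_×_; _,_; ∃-syntax)
open import Data.Sum using (inj₁; inj₂)
open import Function.Bundles using (mk⇔; Equivalence)
open import Relation.Binary.PropositionalEquality using (_≡_; refl)
open import Level renaming (lift to lft) using ()

module _ {St Prop : Set} (sat : St → Prop → Set) where

  ⊕⊤-intro : ∀ {S S₁ : Subset St} {φ : Formula Prop} →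
             (∀ σ → S₁ σ → S σ) → OLsat sat S₁ φ → OLsat sat S (φ ⊕ ⊤ᶠ)
  ⊕⊤-intro {S} {S₁} S₁⊆S S₁⊨φ = S₁ , S , S≐S₁∪S , S₁⊨φ , lft _
    where
    S≐S₁∪S : S ≐ S₁ ∪ S
    S≐S₁∪S σ = mk⇔ inj₂ λ { (inj₁ s₁) → S₁⊆S σ s₁ ; (inj₂ s) → s }

  ⊕⊤-elim : ∀ {S : Subset St} {φ : Formula Prop} →
            OLsat sat S (φ ⊕ ⊤ᶠ) → ∃[ S₁ ] ((∀ σ → S₁ σ → S σ) × OLsat sat S₁ φ)
  ⊕⊤-elim (S₁ , _ , S≐S₁∪S₂ , S₁⊨φ , _) =
    S₁ , (λ σ s₁ → Equivalence.from (S≐S₁∪S₂ σ) (inj₁ s₁)) , S₁⊨φ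

  atom-witness : ∀ {S : Subset St} {Q : Prop} → OLsat sat S (atom Q) → ∃[ τ ] (S τ × sat τ Q)
  atom-witness (lft ((τ , τ∈S) , allQ)) = τ , τ∈S , allQ τ τ∈S

lift-singleton : ∀ {St : Set} (C : Denot St) {σ τ : St} → lift C (σ ≡_) τ → C σ τ
lift-singleton C (_ , refl , c) = c

module _ {St Prop : Set} (sat : St → Prop → Set) (C : Denot St) (P Q : Prop) where

  outcomesSatisfyingQ : Subset St → Subset St
  outcomesSatisfyingQ S τ = lift C S τ × sat τ Q

  BUTriple⇒OLTriple : BUTriple sat P C Q → OLTriple sat (atom P) C (atom Q ⊕ ⊤ᶠ)
  BUTriple⇒OLTriple bu S (lft ((σ , σ∈S) , allP)) =
    ⊕⊤-intro sat {φ = atom Q} (λ _ (τ∈⟦C⟧S , _) → τ∈⟦C⟧S) (lft (reached , λ _ (_ , q) → q))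
    where
    reached : ∃[ τ ] outcomesSatisfyingQ S τ
    reached with bu σ (allP σ σ∈S)
    ... | τ , c , q = τ , (σ , σ∈S , c) , q

  OLTriple⇒BUTriple : OLTriple sat (atom P) C (atom Q ⊕ ⊤ᶠ) → BUTriple sat P C Q
  OLTriple⇒BUTriple ol σ p
    with ⊕⊤-elim sat {φ = atom Q} (ol (σ ≡_) (lft ((σ , refl) , λ { _ refl → p })))
  ... | _ , S₁⊆⟦C⟧σ , S₁⊨Q with atom-witness sat S₁⊨Q
  ... | τ , τ∈S₁ , q = τ , lift-singleton C (S₁⊆⟦C⟧σ τ τ∈S₁) , q

theoremC1 : (St Prop : Set) (sat : St → Prop → Set) (C : Denot St) (P Q : Prop) →
            (BUTriple sat P C Q → OLTriple sat (atom P) C (atom Q ⊕ ⊤ᶠ))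
            × (OLTriple sat (atom P) C (atom Q ⊕ ⊤ᶠ) → BUTriple sat P C Q)
theoremC1 St Prop sat C P Q =
  BUTriple⇒OLTriple sat C P Q , OLTriple⇒BUTriple sat C P Q
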